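{- Let $S$ and $T$ be finite rooted trees with roots $r_S$ and $r_T$, and let $f\colon S\to T$ be an injection (between vertex sets). Then the following are equivalent: (1) $f$ preserves the relations $C$ and $D$; (2) $f$ preserves the relation $C$; (3) $f$ preserves meets, i.e. for all $a,b\in S$ with meet $c$ in $S$, $f(c)$ is the meet of $f(a)$ and $f(b)$ in $T$.
   Context: For a finite tree (acyclic connected graph) $T$ and vertices $a,b$, $ab$ denotes the unique path joining them (a single vertex if $a=b$). $D^T(a,b,c,d)$ holds iff the paths $ab$ and $cd$ share no vertex. For a rooted tree $T$ with root $r$, $C^T(a,b,c)$ holds iff $D^T(a,b,c,r)$. The tree order is $x\le_T y$ iff $x$ lies on the path $ry$, and the meet of $a,b$ is their greatest lower bound with respect to $\le_T$. "$f$ preserves a relation $R$" means $R^S(\bar a)\iff R^T(f(\bar a))$ for all tuples $\bar a$ from $S$. -}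

module Defs where

open import Data.Nat using (ℕ; _≥_)
open import Data.Fin using (Fin)
open import Data.List using (List; []; _∷_; length)
open import Data.List.Membership.Propositional using (_∈_)
open import Data.List.Relation.Unary.Unique.Propositional using (Unique)
open import Data.Product using (Σ; ∃; _×_)
open import Relation.Nullary using (¬_)
open import Relation.Binary.PropositionalEquality using (_≡_)
open import Function.Bundles using (_⇔_)
open import Function.Definitions using (Injective)

data Walk {V : Set} (Adj : V → V → Set) : V → V → List V → Set where
  here  : ∀ {a} → Walk Adj a a (a ∷ [])
  step  : ∀ {a b c xs} → Adj a b → Walk Adj b c xs → Walk Adj a c (a ∷ xs)

IsPath : {V : Set} (Adj : V → V → Set) → V → V → List V → Set
IsPath Adj a b xs = Walk Adj a b xs × Unique xs

record Tree : Set₁ where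
  field
    size    : ℕ
    Adj     : Fin size → Fin size → Set
    irrefl  : ∀ a → ¬ Adj a a
    sym     : ∀ {a b} → Adj a b → Adj b a
    connected : ∀ a b → ∃ λ xs → IsPath Adj a b xs
    -- no cycle: no path v0 … vk with k ≥ 2 and vk adjacent to v0
    acyclic : ∀ a b xs → IsPath Adj a b xs → length xs ≥ 3 → ¬ Adj b a

  V : Set
  V = Fin size

  OnPath : V → V → V → Set
  OnPath a b v = ∃ λ xs → IsPath Adj a b xs × v ∈ xs

  D : V → V → V → V → Set
  D a b c d = ¬ (∃ λ v → OnPath a b v × OnPath c d v)

record RootedTree : Set₁ where
  field
    tree : Tree
  open Tree tree public
  field
    root : V

  C : V → V → V → Set
  C a b c = D a b c root

  _≤T_ : V → V → Set
  x ≤T y = OnPath root y x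

  IsMeet : V → V → V → Set
  IsMeet m a b = m ≤T a × m ≤T b × (∀ d → d ≤T a → d ≤T b → d ≤T m)

open RootedTree

PreservesC : (S T : RootedTree) → (V S → V T) → Set
PreservesC S T f = ∀ a b c → C S a b c ⇔ C T (f a) (f b) (f c)

PreservesD : (S T : RootedTree) → (V S → V T) → Set
PreservesD S T f = ∀ a b c d → D S a b c d ⇔ D T (f a) (f b) (f c) (f d)

PreservesMeets : (S T : RootedTree) → (V S → V T) → Set
PreservesMeets S T f = ∀ a b c → IsMeet S c a b → IsMeet T (f c) (f a) (f b)

module Submission where

-- First, generic facts about repetition-free lists and walks
-- give loop erasure; acyclicity then makes paths unique, so a vertex
-- v on path a b splits it into path a v and path v b.  In a rooted tree
-- this yields the tree order (x ≤ y iff x ∈ path r y), the existence of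
-- meets (the last vertex of path r a lying on path r b), and three
-- characterisations in terms of the meet m of a and b:
--   * v ∈ path a b  iff  m ≤ v and v is below a or below b;
--   * ¬ C a b c     iff  m ≤ c;
--   * if path a b and path c d intersect, one of the two meets lies on
--     the other path.
-- A C-preserving map is monotone, hence preserves meets by the second
-- characterisation.  Conversely a meet-preserving injection preserves
-- and reflects the order, hence C (second characterisation) and, via the
-- first and third, also D.

open import Defs
open import Data.Nat using (_≥_; s≤s; z≤n)
open import Data.Fin.Properties using (_≟_)
open import Data.List using (List; []; _∷_; length; _++_; reverse; [_])
open import Data.List.Properties using (unfold-reverse)
open import Data.List.Membership.Propositional using (_∈_; _∉_; lose)
open import Data.List.Membership.Propositional.Properties using (∈-∃++; ∈-++⁺ˡ; ∈-++⁺ʳ; ∈-++⁻)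
open import Data.List.Relation.Binary.Subset.Propositional using (_⊆_)
open import Data.List.Relation.Unary.Any using (Any; here; there; any?)
import Data.List.Relation.Unary.Any.Properties as AnyP
open import Data.List.Relation.Unary.All as All using (All; []; _∷_)
import Data.List.Relation.Unary.All.Properties as AllP
open import Data.List.Relation.Unary.Unique.Propositional using (Unique; []; _∷_)
import Data.List.Relation.Unary.Unique.Propositional.Properties as UniqueP
open import Data.Product using (∃; _×_; _,_; proj₁; proj₂)
open import Data.Sum using (_⊎_; inj₁; inj₂)
open import Data.Empty using (⊥-elim)
open import Function using (_∘_)
open import Relation.Nullary using (¬_; Dec; yes; no)
open import Relation.Unary using (Decidable)
open import Relation.Binary.Definitions using (Symmetric; DecidableEquality)
open import Relation.Binary.PropositionalEquality using (_≡_; _≢_; refl; sym; cong; subst)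
open import Function.Bundles using (_⇔_; mk⇔; Equivalence)
open import Function.Definitions using (Injective)

module _ {A : Set} where

  Unique-suffix : ∀ {v : A} {suf} pre → Unique (pre ++ v ∷ suf) → Unique (v ∷ suf)
  Unique-suffix []        u       = u
  Unique-suffix (_ ∷ pre) (_ ∷ u) = Unique-suffix pre u

  Unique-prefix : ∀ {v : A} {suf} pre → Unique (pre ++ v ∷ suf) → Unique (pre ++ [ v ])
  Unique-prefix []        _        = [] ∷ []
  Unique-prefix (_ ∷ pre) (p∉ ∷ u) =
    AllP.++⁺ (AllP.++⁻ˡ pre p∉) (All.head (AllP.++⁻ʳ pre p∉) ∷ []) ∷ Unique-prefix pre u

  Unique-junction : ∀ {u v : A} {suf} pre → Unique (pre ++ v ∷ suf) →
    u ∈ pre ++ [ v ] → u ∈ v ∷ suf → u ≡ v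
  Unique-junction []        _        (here refl) _ = refl
  Unique-junction (_ ∷ pre) (p∉ ∷ _) (here refl) q = ⊥-elim (All.lookup p∉ (∈-++⁺ʳ pre q) refl)
  Unique-junction (_ ∷ pre) (_ ∷ u)  (there p)   q = Unique-junction pre u p q

  Unique-snoc : ∀ {xs} {c : A} → Unique xs → c ∉ xs → Unique (xs ++ [ c ])
  Unique-snoc u c∉ = UniqueP.++⁺ u ([] ∷ []) λ { (p , here refl) → c∉ p }

  Unique-reverse : ∀ {xs : List A} → Unique xs → Unique (reverse xs)
  Unique-reverse [] = []
  Unique-reverse {x ∷ xs} (x∉ ∷ u) rewrite unfold-reverse x xs =
    Unique-snoc (Unique-reverse u) λ p → All.lookup x∉ (AnyP.reverse⁻ p) refl

  -- If some element of zs satisfies a decidable P, split zs at the last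
  -- such element.  This is how the meet is found on the path from the root.
  last-satisfying : {P : A → Set} → Decidable P → ∀ zs → Any P zs →
    ∃ λ pre → ∃ λ m → ∃ λ suf → zs ≡ pre ++ m ∷ suf × P m × All (¬_ ∘ P) suf
  last-satisfying P? (z ∷ zs) some with any? P? zs
  ... | yes later with last-satisfying P? zs later
  ...   | pre , m , suf , eq , pm , none = z ∷ pre , m , suf , cong (z ∷_) eq , pm , none
  last-satisfying {P} P? (z ∷ zs) some | no ¬later =
    [] , z , zs , refl , head-satisfies some , AllP.¬Any⇒All¬ zs ¬later
    where
    head-satisfies : Any P (z ∷ zs) → P z
    head-satisfies (here p)  = p
    head-satisfies (there q) = ⊥-elim (¬later q)

module _ {V : Set} {Adj : V → V → Set} where

  walk-source : ∀ {a b xs} → Walk Adj a b xs → a ∈ xs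
  walk-source here       = here refl
  walk-source (step _ _) = here refl

  walk-target : ∀ {a b xs} → Walk Adj a b xs → b ∈ xs
  walk-target here       = here refl
  walk-target (step _ w) = there (walk-target w)

  walk-head : ∀ {a b xs} → Walk Adj a b xs → ∃ λ ys → xs ≡ a ∷ ys
  walk-head here       = _ , refl
  walk-head (step _ _) = _ , refl

  walk-length : ∀ {a b xs} → a ≢ b → Walk Adj a b xs → length xs ≥ 2
  walk-length a≢b here                = ⊥-elim (a≢b refl)
  walk-length a≢b (step _ here)       = s≤s (s≤s z≤n)
  walk-length a≢b (step _ (step _ _)) = s≤s (s≤s z≤n)

  walk-snoc : ∀ {a b c xs} → Walk Adj a b xs → Adj b c → Walk Adj a c (xs ++ [ c ])
  walk-snoc here       e = step e here
  walk-snoc (step d w) e = step d (walk-snoc w e)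

  walk-reverse : Symmetric Adj → ∀ {a b xs} → Walk Adj a b xs → Walk Adj b a (reverse xs)
  walk-reverse _   here = here
  walk-reverse adj {a} (step {xs = xs} e w) rewrite unfold-reverse a xs =
    walk-snoc (walk-reverse adj w) (adj e)

  walk-++ : ∀ {a m b xs ys} → Walk Adj a m xs → Walk Adj m b (m ∷ ys) → Walk Adj a b (xs ++ ys)
  walk-++ here       w' = w'
  walk-++ (step e w) w' = step e (walk-++ w w')

  walk-join : ∀ {a m b xs ys} → Walk Adj a m xs → Walk Adj m b ys →
    ∃ λ zs → Walk Adj a b zs × zs ⊆ xs ++ ys
  walk-join {m = m} {xs = xs} w w' with walk-head w'
  ... | ys , refl = xs ++ ys , walk-++ w w' , widen
    where
    widen : xs ++ ys ⊆ xs ++ m ∷ ys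
    widen p with ∈-++⁻ xs p
    ... | inj₁ q = ∈-++⁺ˡ q
    ... | inj₂ q = ∈-++⁺ʳ xs (there q)

  walk-split : ∀ {a b v suf} pre {xs} → Walk Adj a b xs → xs ≡ pre ++ v ∷ suf →
    Walk Adj a v (pre ++ [ v ]) × Walk Adj v b (v ∷ suf)
  walk-split []            here       refl = here , here
  walk-split []            (step e w) refl = here , step e w
  walk-split (_ ∷ [])      here       ()
  walk-split (_ ∷ _ ∷ _)   here       ()
  walk-split (_ ∷ pre)     (step e w) refl with walk-split pre w refl
  ... | w₁ , w₂ = step e w₁ , w₂

module LoopErasure {V : Set} (_≟ᵥ_ : DecidableEquality V) {Adj : V → V → Set} where
  open import Data.List.Membership.DecPropositional _≟ᵥ_ using (_∈?_)

  erase : ∀ {a b xs} → Walk Adj a b xs → ∃ λ ys → IsPath Adj a b ys × ys ⊆ xs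
  erase here = _ , (here , [] ∷ []) , λ p → p
  erase {a} (step e w) with erase w
  ... | ys , (wy , uy) , ys⊆ with a ∈? ys
  ...   | yes a∈ys with ∈-∃++ a∈ys
  ...     | pre , suf , refl =
    a ∷ suf , (proj₂ (walk-split pre wy refl) , Unique-suffix pre uy) ,
    λ { (here refl) → here refl ; (there q) → there (ys⊆ (∈-++⁺ʳ pre (there q))) }
  erase {a} (step e w) | ys , (wy , uy) , ys⊆ | no a∉ys =
    a ∷ ys , (step e wy , All.tabulate (λ q a≡ → a∉ys (subst (_∈ ys) (sym a≡) q)) ∷ uy) ,
    λ { (here refl) → here refl ; (there q) → there (ys⊆ q) }

module TreePaths (T : Tree) where
  open Tree T renaming (sym to adj-sym)
  open LoopErasure (_≟_ {size}) {Adj}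

  -- Acyclicity makes paths unique: two different first steps from a would
  -- close a cycle through a.
  path-unique : ∀ {a b xs ys} → IsPath Adj a b xs → IsPath Adj a b ys → xs ≡ ys
  path-unique (here , _) (here , _) = refl
  path-unique (here , _) (step _ w , a∉ ∷ _) = ⊥-elim (All.lookup a∉ (walk-target w) refl)
  path-unique (step _ w , a∉ ∷ _) (here , _) = ⊥-elim (All.lookup a∉ (walk-target w) refl)
  path-unique {a} (step {b = x} {xs = xs} ex wx , a∉xs ∷ ux)
                  (step {b = y} {xs = ys} ey wy , a∉ys ∷ uy) with x ≟ y
  ... | yes refl = cong (a ∷_) (path-unique (wx , ux) (wy , uy))
  ... | no x≢y with walk-join wx (walk-reverse adj-sym wy)
  ...   | zs , wz , zs⊆ with erase wz
  ...     | ps , (wp , up) , ps⊆ =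
    ⊥-elim (acyclic a y (a ∷ ps) (step ex wp , a∉ps ∷ up) (s≤s (walk-length x≢y wp)) (adj-sym ey))
    where
    a∉ : ∀ {v} → v ∈ xs ++ reverse ys → a ≢ v
    a∉ p with ∈-++⁻ xs p
    ... | inj₁ q = All.lookup a∉xs q
    ... | inj₂ q = All.lookup a∉ys (AnyP.reverse⁻ q)
    a∉ps : All (a ≢_) ps
    a∉ps = All.tabulate (a∉ ∘ zs⊆ ∘ ps⊆)

  path : V → V → List V
  path a b = proj₁ (connected a b)

  path-isPath : ∀ a b → IsPath Adj a b (path a b)
  path-isPath a b = proj₂ (connected a b)

  onPath⇒∈path : ∀ {a b v} → OnPath a b v → v ∈ path a b
  onPath⇒∈path {a} {b} {v} (_ , p , v∈) = subst (v ∈_) (path-unique p (path-isPath a b)) v∈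

  ∈path⇒onPath : ∀ {a b v} → v ∈ path a b → OnPath a b v
  ∈path⇒onPath {a} {b} v∈ = path a b , path-isPath a b , v∈

  path-source : ∀ a b → a ∈ path a b
  path-source a b = walk-source (proj₁ (path-isPath a b))

  path-target : ∀ a b → b ∈ path a b
  path-target a b = walk-target (proj₁ (path-isPath a b))

  path-sym : ∀ {a b v} → v ∈ path a b → v ∈ path b a
  path-sym {a} {b} v∈ =
    subst (_ ∈_) (path-unique (walk-reverse adj-sym w , Unique-reverse u) (path-isPath b a))
          (AnyP.reverse⁺ v∈)
    where
    w : Walk Adj a b (path a b)
    w = proj₁ (path-isPath a b)
    u : Unique (path a b)
    u = proj₂ (path-isPath a b)

  record Split (a b v : V) : Set where
    field
      pre suf : List V
      path-ab : path a b ≡ pre ++ v ∷ suf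
      path-av : path a v ≡ pre ++ [ v ]
      path-vb : path v b ≡ v ∷ suf

  split-at : ∀ {a b v} pre suf → path a b ≡ pre ++ v ∷ suf → Split a b v
  split-at {a} {b} {v} pre suf eq = record
    { pre = pre ; suf = suf ; path-ab = eq
    ; path-av = path-unique (path-isPath a v) (proj₁ pieces , Unique-prefix pre u)
    ; path-vb = path-unique (path-isPath v b) (proj₂ pieces , Unique-suffix pre u) }
    where
    u : Unique (pre ++ v ∷ suf)
    u = subst Unique eq (proj₂ (path-isPath a b))
    pieces : Walk Adj a v (pre ++ [ v ]) × Walk Adj v b (v ∷ suf)
    pieces = walk-split pre (proj₁ (path-isPath a b)) eq

  split : ∀ {a b v} → v ∈ path a b → Split a b v
  split v∈ with ∈-∃++ v∈
  ... | pre , suf , eq = split-at pre suf eq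

  subpath-left : ∀ {a b v u} → v ∈ path a b → u ∈ path a v → u ∈ path a b
  subpath-left {u = u} v∈ u∈ with split v∈
  ... | record { pre = pre ; path-ab = ab ; path-av = av } with ∈-++⁻ pre (subst (u ∈_) av u∈)
  ...   | inj₁ q           = subst (u ∈_) (sym ab) (∈-++⁺ˡ q)
  ...   | inj₂ (here refl) = v∈

  subpath-right : ∀ {a b v u} → v ∈ path a b → u ∈ path v b → u ∈ path a b
  subpath-right {u = u} v∈ u∈ with split v∈
  ... | record { pre = pre ; path-ab = ab ; path-vb = vb } =
    subst (u ∈_) (sym ab) (∈-++⁺ʳ pre (subst (u ∈_) vb u∈))

  subpaths-cover : ∀ {a b v u} → v ∈ path a b → u ∈ path a b → u ∈ path a v ⊎ u ∈ path v b
  subpaths-cover {u = u} v∈ u∈ with split v∈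
  ... | record { pre = pre ; path-ab = ab ; path-av = av ; path-vb = vb }
    with ∈-++⁻ pre (subst (u ∈_) ab u∈)
  ...   | inj₁ q = inj₁ (subst (u ∈_) (sym av) (∈-++⁺ˡ q))
  ...   | inj₂ q = inj₂ (subst (u ∈_) (sym vb) q)

  subpaths-meet : ∀ {a b v u} → v ∈ path a b → u ∈ path a v → u ∈ path v b → u ≡ v
  subpaths-meet {a} {b} {u = u} v∈ p q with split v∈
  ... | record { pre = pre ; path-ab = ab ; path-av = av ; path-vb = vb } =
    Unique-junction pre (subst Unique ab (proj₂ (path-isPath a b)))
                    (subst (u ∈_) av p) (subst (u ∈_) vb q)

  path-linear : ∀ {x y u v} → u ∈ path x y → v ∈ path x y → u ∈ path x v ⊎ v ∈ path x u
  path-linear u∈ v∈ with subpaths-cover v∈ u∈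
  ... | inj₁ u∈xv = inj₁ u∈xv
  ... | inj₂ u∈vy with subpaths-cover u∈ v∈
  ...   | inj₁ v∈xu = inj₂ v∈xu
  ...   | inj₂ v∈uy with subpaths-meet u∈vy (path-source _ _) v∈uy
  ...     | refl = inj₁ (path-target _ _)

  path-concat : ∀ {a m b} → (∀ {u} → u ∈ path a m → u ∈ path m b → u ≡ m) → m ∈ path a b
  path-concat {a} {m} {b} only-m with walk-head (proj₁ (path-isPath m b))
  ... | ys , eq with subst Unique eq (proj₂ (path-isPath m b))
  ...   | m∉ys ∷ u-ys =
    subst (m ∈_) (path-unique glued (path-isPath a b)) (∈-++⁺ˡ (path-target a m))
    where
    disjoint : ∀ {u} → u ∈ path a m → u ∉ ys
    disjoint p q with only-m p (subst (_ ∈_) (sym eq) (there q))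
    ... | refl = All.lookup m∉ys q refl
    glued : IsPath Adj a b (path a m ++ ys)
    glued = walk-++ (proj₁ (path-isPath a m)) (subst (Walk Adj m b) eq (proj₁ (path-isPath m b)))
          , UniqueP.++⁺ (proj₂ (path-isPath a m)) u-ys λ { (p , q) → disjoint p q }

module RootedPaths (R : RootedTree) where
  open RootedTree R hiding (sym)
  open TreePaths tree public
  open import Data.List.Membership.DecPropositional (_≟_ {size}) using (_∈?_)

  r : V
  r = root

  _≤_ : V → V → Set
  x ≤ y = x ∈ path r y

  _≤?_ : ∀ x y → Dec (x ≤ y)
  x ≤? y = x ∈? path r y

  ≤-refl : ∀ x → x ≤ x
  ≤-refl x = path-target r x

  ≤-trans : ∀ {x y z} → x ≤ y → y ≤ z → x ≤ z
  ≤-trans x≤y y≤z = subpath-left y≤z x≤y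

  ≤-antisym : ∀ {x y} → x ≤ y → y ≤ x → x ≡ y
  ≤-antisym {x} {y} x≤y y≤x = sym (subpaths-meet x≤y y≤x (path-target x y))

  ≤-along : ∀ {m a v} → m ≤ a → v ∈ path m a → m ≤ v
  ≤-along {m} {a} {v} m≤a v∈ with path-linear (subpath-right m≤a v∈) m≤a
  ... | inj₂ m≤v = m≤v
  ... | inj₁ v≤m with subpaths-meet m≤a v≤m v∈
  ...   | refl = ≤-refl v

  IsGLB : V → V → V → Set
  IsGLB m a b = m ≤ a × m ≤ b × (∀ d → d ≤ a → d ≤ b → d ≤ m)

  isMeet⇒isGLB : ∀ {m a b} → IsMeet m a b → IsGLB m a b
  isMeet⇒isGLB (p , q , g) =
    onPath⇒∈path p , onPath⇒∈path q , λ d x y → onPath⇒∈path (g d (∈path⇒onPath x) (∈path⇒onPath y))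

  isGLB⇒isMeet : ∀ {m a b} → IsGLB m a b → IsMeet m a b
  isGLB⇒isMeet (p , q , g) =
    ∈path⇒onPath p , ∈path⇒onPath q , λ d x y → ∈path⇒onPath (g d (onPath⇒∈path x) (onPath⇒∈path y))

  glb-unique : ∀ {m m' a b} → IsGLB m a b → IsGLB m' a b → m ≡ m'
  glb-unique (p , q , g) (p' , q' , g') = ≤-antisym (g' _ p q) (g _ p' q')

  glb-of-≤ : ∀ {x y} → x ≤ y → IsGLB x x y
  glb-of-≤ {x} x≤y = ≤-refl x , x≤y , λ _ d≤x _ → d≤x

  -- Meets exist: the last vertex of path r a lying on path r b is the meet
  -- of a and b, and it lies on path a b.
  record Meet (a b : V) : Set where
    field
      m        : V
      isGLB    : IsGLB m a b
      on-path  : m ∈ path a b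

  meet : ∀ a b → Meet a b
  meet a b with last-satisfying (_∈? path r b) (path r a) (lose (path-source r a) (path-source r b))
  ... | pre , m , suf , eq , m≤b , suf≰b =
    record { m = m ; isGLB = m≤a , m≤b , greatest ; on-path = path-concat only-m }
    where
    open Split (split-at pre suf eq) using (path-av; path-vb)
    m≤a : m ≤ a
    m≤a = subst (m ∈_) (sym eq) (∈-++⁺ʳ pre (here refl))
    greatest : ∀ d → d ≤ a → d ≤ b → d ≤ m
    greatest d d≤a d≤b with ∈-++⁻ pre (subst (d ∈_) eq d≤a)
    ... | inj₁ q           = subst (d ∈_) (sym path-av) (∈-++⁺ˡ q)
    ... | inj₂ (here refl) = ≤-refl m
    ... | inj₂ (there q)   = ⊥-elim (All.lookup suf≰b q d≤b)
    only-m : ∀ {u} → u ∈ path a m → u ∈ path m b → u ≡ m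
    only-m {u} p q with subst (u ∈_) path-vb (path-sym p)
    ... | here refl = refl
    ... | there s   = ⊥-elim (All.lookup suf≰b s (subpath-right m≤b q))

  glb-on-path : ∀ {m a b} → IsGLB m a b → m ∈ path a b
  glb-on-path {m} {a} {b} glb =
    subst (_∈ path a b) (glb-unique (Meet.isGLB (meet a b)) glb) (Meet.on-path (meet a b))

  between⇒ : ∀ {m a b v} → IsGLB m a b → v ∈ path a b → m ≤ v × (v ≤ a ⊎ v ≤ b)
  between⇒ {m} {a} {b} {v} glb v∈ = on-half (subpaths-cover (glb-on-path glb) v∈)
    where
    m≤a : m ≤ a
    m≤a = proj₁ glb
    m≤b : m ≤ b
    m≤b = proj₁ (proj₂ glb)
    on-half : v ∈ path a m ⊎ v ∈ path m b → m ≤ v × (v ≤ a ⊎ v ≤ b)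
    on-half (inj₁ q) = ≤-along m≤a (path-sym q) , inj₁ (subpath-right m≤a (path-sym q))
    on-half (inj₂ q) = ≤-along m≤b q , inj₂ (subpath-right m≤b q)

  between⇐ : ∀ {m a b v} → IsGLB m a b → m ≤ v → (v ≤ a ⊎ v ≤ b) → v ∈ path a b
  between⇐ glb@(m≤a , _ , _) m≤v (inj₁ v≤a) with subpaths-cover m≤a v≤a
  ... | inj₁ v≤m = subst (_∈ _) (≤-antisym m≤v v≤m) (glb-on-path glb)
  ... | inj₂ q   = subpath-left (glb-on-path glb) (path-sym q)
  between⇐ glb@(_ , m≤b , _) m≤v (inj₂ v≤b) with subpaths-cover m≤b v≤b
  ... | inj₁ v≤m = subst (_∈ _) (≤-antisym m≤v v≤m) (glb-on-path glb)
  ... | inj₂ q   = subpath-right (glb-on-path glb) q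

  glb≤⇒¬C : ∀ {m a b c} → IsGLB m a b → m ≤ c → ¬ C a b c
  glb≤⇒¬C glb m≤c c-disjoint =
    c-disjoint (_ , ∈path⇒onPath (glb-on-path glb) , ∈path⇒onPath (path-sym m≤c))

  ¬C⇒glb≤ : ∀ {m a b c} → IsGLB m a b → ¬ C a b c → m ≤ c
  ¬C⇒glb≤ {m} {c = c} glb ¬c with m ≤? c
  ... | yes m≤c = m≤c
  ... | no  m≰c = ⊥-elim (¬c λ (_ , p , q) →
    m≰c (≤-trans (proj₁ (between⇒ glb (onPath⇒∈path p))) (path-sym (onPath⇒∈path q))))

  ≤-lower : ∀ {x y a b} → x ≤ y → (y ≤ a ⊎ y ≤ b) → (x ≤ a ⊎ x ≤ b)
  ≤-lower x≤y (inj₁ q) = inj₁ (≤-trans x≤y q)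
  ≤-lower x≤y (inj₂ q) = inj₂ (≤-trans x≤y q)

  -- If two paths share a vertex v, then the higher of their two meets lies
  -- on the other path (both meets lie below v, so they are comparable).
  paths-cross : ∀ {m₁ m₂ a b c d v} → IsGLB m₁ a b → IsGLB m₂ c d →
    v ∈ path a b → v ∈ path c d → m₁ ∈ path c d ⊎ m₂ ∈ path a b
  paths-cross {m₁} {m₂} {a} {b} {c} {d} {v} glb₁ glb₂ v∈ab v∈cd = compare (path-linear m₁≤v m₂≤v)
    where
    m₁≤v : m₁ ≤ v
    m₁≤v = proj₁ (between⇒ glb₁ v∈ab)
    m₂≤v : m₂ ≤ v
    m₂≤v = proj₁ (between⇒ glb₂ v∈cd)
    compare : m₁ ≤ m₂ ⊎ m₂ ≤ m₁ → m₁ ∈ path c d ⊎ m₂ ∈ path a b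
    compare (inj₁ m₁≤m₂) = inj₂ (between⇐ glb₁ m₁≤m₂ (≤-lower m₂≤v (proj₂ (between⇒ glb₁ v∈ab))))
    compare (inj₂ m₂≤m₁) = inj₁ (between⇐ glb₂ m₂≤m₁ (≤-lower m₁≤v (proj₂ (between⇒ glb₂ v∈cd))))

module Maps (S T : RootedTree) (f : RootedTree.V S → RootedTree.V T) where
  module S = RootedPaths S
  module T = RootedPaths T
  open Equivalence

  -- A C-preserving map is monotone: x ≤ y iff ¬ C x x y.
  C⇒monotone : PreservesC S T f → ∀ {x y} → x S.≤ y → f x T.≤ f y
  C⇒monotone pc {x} {y} x≤y =
    T.¬C⇒glb≤ (T.glb-of-≤ (T.≤-refl (f x)))
      λ c → S.glb≤⇒¬C (S.glb-of-≤ (S.≤-refl x)) x≤y (from (pc x x y) c)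

  -- A C-preserving map preserves meets: the meet m' of f a and f b
  -- satisfies ¬ C (f a) (f b) (f c), hence m' ≤ f c, for the meet c of a, b.
  C⇒meets : PreservesC S T f → PreservesMeets S T f
  C⇒meets pc a b c isMeet = T.isGLB⇒isMeet (mono c≤a , mono c≤b , greatest)
    where
    mono : ∀ {x y} → x S.≤ y → f x T.≤ f y
    mono = C⇒monotone pc
    glb : S.IsGLB c a b
    glb = S.isMeet⇒isGLB isMeet
    c≤a : c S.≤ a
    c≤a = proj₁ glb
    c≤b : c S.≤ b
    c≤b = proj₁ (proj₂ glb)
    open T.Meet (T.meet (f a) (f b)) using () renaming (m to m'; isGLB to glb')
    m'≤fc : m' T.≤ f c
    m'≤fc = T.¬C⇒glb≤ glb' λ c' → S.glb≤⇒¬C glb (S.≤-refl c) (from (pc a b c) c')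
    greatest : ∀ d → d T.≤ f a → d T.≤ f b → d T.≤ f c
    greatest d d≤fa d≤fb = T.≤-trans (proj₂ (proj₂ glb') d d≤fa d≤fb) m'≤fc

  module MeetPreserving (inj : Injective _≡_ _≡_ f) (pm : PreservesMeets S T f) where

    glb-image : ∀ {m a b} → S.IsGLB m a b → T.IsGLB (f m) (f a) (f b)
    glb-image glb = T.isMeet⇒isGLB (pm _ _ _ (S.isGLB⇒isMeet glb))

    meet-image : ∀ a b → T.IsGLB (f (S.Meet.m (S.meet a b))) (f a) (f b)
    meet-image a b = glb-image (S.Meet.isGLB (S.meet a b))

    -- f preserves the order (x is the meet of x and y) and, being
    -- injective, reflects it (f x is the meet of f x and f y).
    monotone : ∀ {x y} → x S.≤ y → f x T.≤ f y
    monotone x≤y = proj₁ (proj₂ (glb-image (S.glb-of-≤ x≤y)))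

    reflects : ∀ {x y} → f x T.≤ f y → x S.≤ y
    reflects {x} {y} fx≤fy =
      subst (S._≤ y) (inj (T.glb-unique (meet-image x y) (T.glb-of-≤ fx≤fy)))
            (proj₁ (proj₂ (S.Meet.isGLB (S.meet x y))))

    monotone-or : ∀ {v a b} → (v S.≤ a ⊎ v S.≤ b) → (f v T.≤ f a ⊎ f v T.≤ f b)
    monotone-or (inj₁ v≤a) = inj₁ (monotone v≤a)
    monotone-or (inj₂ v≤b) = inj₂ (monotone v≤b)

    reflects-or : ∀ {v a b} → (f v T.≤ f a ⊎ f v T.≤ f b) → (v S.≤ a ⊎ v S.≤ b)
    reflects-or (inj₁ fv≤fa) = inj₁ (reflects fv≤fa)
    reflects-or (inj₂ fv≤fb) = inj₂ (reflects fv≤fb)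

    -- Preservation of C: both sides say "the meet of a and b is not ≤ c".
    preservesC : PreservesC S T f
    preservesC a b c = mk⇔
      (λ cS cT → S.glb≤⇒¬C glb (reflects (T.¬C⇒glb≤ (glb-image glb) (λ c' → c' cT))) cS)
      (λ cT cS → T.glb≤⇒¬C (glb-image glb) (monotone (S.¬C⇒glb≤ glb (λ c' → c' cS))) cT)
      where open S.Meet (S.meet a b) using () renaming (isGLB to glb)

    on-path : ∀ {a b v} → v ∈ S.path a b → f v ∈ T.path (f a) (f b)
    on-path {a} {b} {v} v∈ =
      T.between⇐ (meet-image a b) (monotone (proj₁ between)) (monotone-or (proj₂ between))
      where
      between : S.Meet.m (S.meet a b) S.≤ v × (v S.≤ a ⊎ v S.≤ b)
      between = S.between⇒ (S.Meet.isGLB (S.meet a b)) v∈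

    on-path⁻ : ∀ {a b v} → f v ∈ T.path (f a) (f b) → v ∈ S.path a b
    on-path⁻ {a} {b} {v} fv∈ =
      S.between⇐ (S.Meet.isGLB (S.meet a b)) (reflects (proj₁ between)) (reflects-or (proj₂ between))
      where
      between : f (S.Meet.m (S.meet a b)) T.≤ f v × (f v T.≤ f a ⊎ f v T.≤ f b)
      between = T.between⇒ (meet-image a b) fv∈

    -- Preservation of D: disjoint paths stay disjoint because a common vertex
    -- of the image paths can be replaced by one of the two image meets.
    preservesD : PreservesD S T f
    preservesD a b c d = mk⇔ to′ from′
      where
      open S.Meet (S.meet a b) using () renaming (m to m₁; isGLB to glb₁)
      open S.Meet (S.meet c d) using () renaming (m to m₂; isGLB to glb₂)
      common-vertex : f m₁ ∈ T.path (f c) (f d) ⊎ f m₂ ∈ T.path (f a) (f b) →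
        ¬ RootedTree.D S a b c d
      common-vertex (inj₁ fm₁∈) dS =
        dS (m₁ , S.∈path⇒onPath (S.glb-on-path glb₁) , S.∈path⇒onPath (on-path⁻ fm₁∈))
      common-vertex (inj₂ fm₂∈) dS =
        dS (m₂ , S.∈path⇒onPath (on-path⁻ fm₂∈) , S.∈path⇒onPath (S.glb-on-path glb₂))
      to′ : RootedTree.D S a b c d → RootedTree.D T (f a) (f b) (f c) (f d)
      to′ dS (_ , p , q) = common-vertex
        (T.paths-cross (glb-image glb₁) (glb-image glb₂) (T.onPath⇒∈path p) (T.onPath⇒∈path q)) dS
      from′ : RootedTree.D T (f a) (f b) (f c) (f d) → RootedTree.D S a b c d
      from′ dT (v , p , q) = dT (f v , image p , image q)
        where
        image : ∀ {x y} → RootedTree.OnPath S x y v → RootedTree.OnPath T (f x) (f y) (f v)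
        image = T.∈path⇒onPath ∘ on-path ∘ S.onPath⇒∈path

proposition3p3 : (S T : RootedTree) (f : RootedTree.V S → RootedTree.V T) →
    Injective _≡_ _≡_ f →
    ((PreservesC S T f × PreservesD S T f) ⇔ PreservesC S T f)
      × (PreservesC S T f ⇔ PreservesMeets S T f)
proposition3p3 S T f inj =
  mk⇔ proj₁ (λ pc → pc , MeetPreserving.preservesD inj (C⇒meets pc)) ,
  mk⇔ C⇒meets (MeetPreserving.preservesC inj)
  where open Maps S T f
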